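{- For $n\ge 1$ and $0\le k\le n-1$ let $\mathbf{e}_k\in\mathbb{F}_2^n$ be the sequence with a $1$ in position $k$ (positions numbered $0,\ldots,n-1$) and $0$ elsewhere. Then: (i) $|T(\mathbf{e}_0)|=n$ for $n\ge 1$; (ii) $|T(\mathbf{e}_1)|=\lfloor(3n-2)/2\rfloor$ for $n\ge 2$; (iii) for $n\ge 3$, $|T(\mathbf{e}_2)|=2n-4$ if $n\equiv 2\pmod 4$ and $|T(\mathbf{e}_2)|=2n-3$ otherwise; (iv) for $n\ge 4$, $|T(\mathbf{e}_3)|=(9n-27)/4$ if $n\equiv 3\pmod 4$ and $|T(\mathbf{e}_3)|=\lfloor(9n-20)/4\rfloor$ otherwise.
   Context: For $\mathbf{x}=(x_0,\ldots,x_{n-1})\in\mathbb{F}_2^n$, the derivative is $\partial\mathbf{x}=(x_0+x_1,\ldots,x_{n-2}+x_{n-1})\in\mathbb{F}_2^{n-1}$, with $\partial^0\mathbf{x}=\mathbf{x}$ and $\partial^i\mathbf{x}=\partial(\partial^{i-1}\mathbf{x})$. The Steinhaus triangle is $T(\mathbf{x})=(\mathbf{x},\partial\mathbf{x},\ldots,\partial^{n-1}\mathbf{x})$; $|\mathbf{y}|$ is the number of ones of a binary sequence and $|T(\mathbf{x})|=\sum_{i=0}^{n-1}|\partial^i\mathbf{x}|$. -}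

module Defs where

open import Data.Bool using (Bool; true; false; _xor_)
open import Data.Nat using (ℕ; zero; suc; _+_)
open import Data.List using (List; []; _∷_; replicate; _++_; map; length)
open import Data.Nat.ListAction using (sum)

-- A binary sequence x ∈ 𝔽₂ⁿ is a list of booleans of length n
-- (true = 1, false = 0; addition in 𝔽₂ is xor).

∂ : List Bool → List Bool
∂ []           = []
∂ (x ∷ [])     = []
∂ (x ∷ y ∷ xs) = (x xor y) ∷ ∂ (y ∷ xs)

∂^ : ℕ → List Bool → List Bool
∂^ zero    x = x
∂^ (suc i) x = ∂ (∂^ i x)

weight : List Bool → ℕ
weight []           = 0
weight (true  ∷ xs) = suc (weight xs)
weight (false ∷ xs) = weight xs

rows : ℕ → List Bool → List (List Bool)
rows zero    x = []
rows (suc m) x = x ∷ rows m (∂ x)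

T : List Bool → List (List Bool)
T x = rows (length x) x

weightT : List Bool → ℕ
weightT x = sum (map weight (T x))

-- e_k ∈ 𝔽₂ⁿ: 1 in position k, 0 elsewhere (meaningful for k ≤ n-1)
e : (n k : ℕ) → List Bool
e zero    k       = []
e (suc n) zero    = true ∷ replicate n false
e (suc n) (suc k) = false ∷ e n k

module Submission where

-- Write eₖ ∈ 𝔽₂^(k+1+m) as u ++ 0ᵐ with u = eₖ ∈ 𝔽₂^(k+1). The trailing zeros only
-- shrink under ∂, so the first m rows of T(eₖ) are the iterates ∂₀ⁱu padded with
-- zeros, and the last k+1 rows form T(∂₀ᵐu). On 𝔽₂^(k+1) the map ∂₀ is I + N with N
-- the shift, N^(k+1) = 0, and in characteristic 2 we have (I + N)^(2ʲ) = I + N^(2ʲ);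
-- so for k ≤ 3 the vector u is periodic under ∂₀, with periods 1, 2, 4, 4. Lengthening
-- eₖ by one period therefore adds the weight of one orbit (1, 3, 8, 9), and the four
-- closed forms satisfy the same recurrences.

open import Defs
open import Data.Bool using (Bool; true; false)
open import Data.Empty using (⊥-elim)
open import Data.List using (List; []; _∷_; replicate; _++_; map; length)
open import Data.List.Properties using (++-identityʳ; length-replicate)
open import Data.Nat using (ℕ; zero; suc; _+_; _*_; _∸_; _≤_; _%_; _/_; s≤s; NonZero)
open import Data.Nat.DivMod using ([m+n]%n≡m%n; +-distrib-/-∣ˡ)
open import Data.Nat.Divisibility using (_∣_; divides-refl)
open import Data.Nat.ListAction using (sum)
open import Data.Nat.Properties using (+-comm; +-assoc; +-∸-assoc; *-distribˡ-+; *-monoʳ-≤; ≤-trans; m≤m+n)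
open import Data.Product using (_×_; _,_)
open import Relation.Binary.PropositionalEquality
  using (_≡_; _≢_; refl; sym; trans; cong; cong₂; subst; module ≡-Reasoning)

-- The first length p entries of the derivative of p followed by infinitely many zeros.
∂₀ : List Bool → List Bool
∂₀ p = ∂ (p ++ false ∷ [])

∂₀^ : ℕ → List Bool → List Bool
∂₀^ zero    p = p
∂₀^ (suc m) p = ∂₀^ m (∂₀ p)

orbitWeight : ℕ → List Bool → ℕ
orbitWeight zero    p = 0
orbitWeight (suc m) p = weight p + orbitWeight m (∂₀ p)

rowsWeight : ℕ → List Bool → ℕ
rowsWeight m x = sum (map weight (rows m x))

∂₀^-+ : ∀ q m p → ∂₀^ (q + m) p ≡ ∂₀^ m (∂₀^ q p)
∂₀^-+ zero    m p = refl
∂₀^-+ (suc q) m p = ∂₀^-+ q m (∂₀ p)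

orbitWeight-+ : ∀ q m p → orbitWeight (q + m) p ≡ orbitWeight q p + orbitWeight m (∂₀^ q p)
orbitWeight-+ zero    m p = refl
orbitWeight-+ (suc q) m p =
  trans (cong (weight p +_) (orbitWeight-+ q m (∂₀ p))) (sym (+-assoc (weight p) _ _))

∂-replicate-false : ∀ m → ∂ (replicate (suc m) false) ≡ replicate m false
∂-replicate-false zero    = refl
∂-replicate-false (suc m) = cong (false ∷_) (∂-replicate-false m)

∂-++-replicate-false : ∀ p m → ∂ (p ++ replicate (suc m) false) ≡ ∂₀ p ++ replicate m false
∂-++-replicate-false []          m = ∂-replicate-false m
∂-++-replicate-false (a ∷ [])    m = cong (_ ∷_) (∂-replicate-false m)
∂-++-replicate-false (a ∷ b ∷ p) m = cong (_ ∷_) (∂-++-replicate-false (b ∷ p) m)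

weight-replicate-false : ∀ m → weight (replicate m false) ≡ 0
weight-replicate-false zero    = refl
weight-replicate-false (suc m) = weight-replicate-false m

weight-++-replicate-false : ∀ p m → weight (p ++ replicate m false) ≡ weight p
weight-++-replicate-false []          m = weight-replicate-false m
weight-++-replicate-false (true ∷ p)  m = cong suc (weight-++-replicate-false p m)
weight-++-replicate-false (false ∷ p) m = weight-++-replicate-false p m

rowsWeight-++-replicate-false : ∀ m j p →
  rowsWeight (m + j) (p ++ replicate m false) ≡ orbitWeight m p + rowsWeight j (∂₀^ m p)
rowsWeight-++-replicate-false zero    j p = cong (rowsWeight j) (++-identityʳ p)
rowsWeight-++-replicate-false (suc m) j p = begin
  weight (p ++ replicate (suc m) false) + rowsWeight (m + j) (∂ (p ++ replicate (suc m) false))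
    ≡⟨ cong₂ _+_ (weight-++-replicate-false p (suc m))
                 (cong (rowsWeight (m + j)) (∂-++-replicate-false p m)) ⟩
  weight p + rowsWeight (m + j) (∂₀ p ++ replicate m false)
    ≡⟨ cong (weight p +_) (rowsWeight-++-replicate-false m j (∂₀ p)) ⟩
  weight p + (orbitWeight m (∂₀ p) + rowsWeight j (∂₀^ m (∂₀ p)))
    ≡⟨ sym (+-assoc (weight p) _ _) ⟩
  orbitWeight (suc m) p + rowsWeight j (∂₀^ (suc m) p)
    ∎
  where open ≡-Reasoning

length-e : ∀ n k → length (e n k) ≡ n
length-e zero    k       = refl
length-e (suc n) zero    = cong suc (length-replicate n)
length-e (suc n) (suc k) = cong suc (length-e n k)

e-suc-+ : ∀ k m → e (suc k + m) k ≡ e (suc k) k ++ replicate m false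
e-suc-+ zero    m = refl
e-suc-+ (suc k) m = cong (false ∷_) (e-suc-+ k m)

weightT-e : ∀ k m →
  weightT (e (suc k + m) k) ≡ orbitWeight m (e (suc k) k) + rowsWeight (suc k) (∂₀^ m (e (suc k) k))
weightT-e k m = begin
  rowsWeight (length (e (suc k + m) k)) (e (suc k + m) k)
    ≡⟨ cong₂ rowsWeight (trans (length-e (suc k + m) k) (+-comm (suc k) m)) (e-suc-+ k m) ⟩
  rowsWeight (m + suc k) (e (suc k) k ++ replicate m false)
    ≡⟨ rowsWeight-++-replicate-false m (suc k) (e (suc k) k) ⟩
  orbitWeight m (e (suc k) k) + rowsWeight (suc k) (∂₀^ m (e (suc k) k))
    ∎
  where open ≡-Reasoning

weightT-e-periodic : ∀ q k m → ∂₀^ q (e (suc k) k) ≡ e (suc k) k →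
  weightT (e (suc k + (q + m)) k) ≡ orbitWeight q (e (suc k) k) + weightT (e (suc k + m) k)
weightT-e-periodic q k m period = begin
  weightT (e (suc k + (q + m)) k)
    ≡⟨ weightT-e k (q + m) ⟩
  orbitWeight (q + m) u + rowsWeight (suc k) (∂₀^ (q + m) u)
    ≡⟨ cong₂ _+_ (orbitWeight-+ q m u) (cong (rowsWeight (suc k)) (∂₀^-+ q m u)) ⟩
  orbitWeight q u + orbitWeight m (∂₀^ q u) + rowsWeight (suc k) (∂₀^ m (∂₀^ q u))
    ≡⟨ cong (λ v → orbitWeight q u + orbitWeight m v + rowsWeight (suc k) (∂₀^ m v)) period ⟩
  orbitWeight q u + orbitWeight m u + rowsWeight (suc k) (∂₀^ m u)
    ≡⟨ +-assoc (orbitWeight q u) _ _ ⟩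
  orbitWeight q u + (orbitWeight m u + rowsWeight (suc k) (∂₀^ m u))
    ≡⟨ cong (orbitWeight q u +_) (sym (weightT-e k m)) ⟩
  orbitWeight q u + weightT (e (suc k + m) k)
    ∎
  where
  open ≡-Reasoning
  u = e (suc k) k

*-+-∸ : ∀ a q n b → b ≤ a * n → a * (q + n) ∸ b ≡ a * q + (a * n ∸ b)
*-+-∸ a q n b b≤an = trans (cong (_∸ b) (*-distribˡ-+ a q n)) (+-∸-assoc (a * q) b≤an)

*-+-∸-/ : ∀ a q n b d .{{_ : NonZero d}} → d ∣ a * q → b ≤ a * n →
  (a * (q + n) ∸ b) / d ≡ (a * q) / d + (a * n ∸ b) / d
*-+-∸-/ a q n b d d∣aq b≤an =
  trans (cong (_/ d) (*-+-∸ a q n b b≤an)) (+-distrib-/-∣ˡ (a * n ∸ b) d∣aq)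

ByResidue : ℕ → (ℕ → ℕ) → (ℕ → ℕ) → ℕ → ℕ → Set
ByResidue r f g n w = (n % 4 ≡ r → w ≡ f n) × (n % 4 ≢ r → w ≡ g n)

ByResidue-step : ∀ {r} f g n {w} c → f (4 + n) ≡ c + f n → g (4 + n) ≡ c + g n →
  ByResidue r f g n w → ByResidue r f g (4 + n) (c + w)
ByResidue-step f g n c f-step g-step (on-r , off-r) =
  (λ eq → trans (cong (c +_) (on-r (trans (sym residue) eq))) (sym f-step))
  , (λ neq → trans (cong (c +_) (off-r (λ eq → neq (trans residue eq)))) (sym g-step))
  where
  residue : (4 + n) % 4 ≡ n % 4
  residue = trans (cong (_% 4) (+-comm 4 n)) ([m+n]%n≡m%n n 4)

weightT-e₀ : ∀ m → weightT (e (1 + m) 0) ≡ 1 + m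
weightT-e₀ zero    = refl
weightT-e₀ (suc m) = trans (weightT-e-periodic 1 0 m refl) (cong suc (weightT-e₀ m))

weightT-e₁ : ∀ m → weightT (e (2 + m) 1) ≡ (3 * (2 + m) ∸ 2) / 2
weightT-e₁ 0 = refl
weightT-e₁ 1 = refl
weightT-e₁ (suc (suc m)) = begin
  weightT (e (2 + (2 + m)) 1)      ≡⟨ weightT-e-periodic 2 1 m refl ⟩
  3 + weightT (e (2 + m) 1)        ≡⟨ cong (3 +_) (weightT-e₁ m) ⟩
  3 + (3 * (2 + m) ∸ 2) / 2        ≡⟨ sym (*-+-∸-/ 3 2 (2 + m) 2 2 (divides-refl 3) 2≤3*n) ⟩
  (3 * (2 + (2 + m)) ∸ 2) / 2      ∎
  where
  open ≡-Reasoning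
  2≤3*n : 2 ≤ 3 * (2 + m)
  2≤3*n = ≤-trans (m≤m+n 2 4) (*-monoʳ-≤ 3 (m≤m+n 2 m))

twice-minus-4 twice-minus-3 : ℕ → ℕ
twice-minus-4 n = 2 * n ∸ 4
twice-minus-3 n = 2 * n ∸ 3

weightT-e₂ : ∀ m → ByResidue 2 twice-minus-4 twice-minus-3 (3 + m) (weightT (e (3 + m) 2))
weightT-e₂ 0 = (λ ()) , (λ _ → refl)
weightT-e₂ 1 = (λ ()) , (λ _ → refl)
weightT-e₂ 2 = (λ ()) , (λ _ → refl)
weightT-e₂ 3 = (λ _ → refl) , (λ r≢2 → ⊥-elim (r≢2 refl))
weightT-e₂ (suc (suc (suc (suc m)))) =
  subst (ByResidue 2 twice-minus-4 twice-minus-3 (7 + m)) (sym (weightT-e-periodic 4 2 m refl))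
        (ByResidue-step twice-minus-4 twice-minus-3 (3 + m) 8
          (*-+-∸ 2 4 (3 + m) 4 (≤-trans (m≤m+n 4 2) 2*3≤2*n))
          (*-+-∸ 2 4 (3 + m) 3 (≤-trans (m≤m+n 3 3) 2*3≤2*n))
          (weightT-e₂ m))
  where
  2*3≤2*n : 2 * 3 ≤ 2 * (3 + m)
  2*3≤2*n = *-monoʳ-≤ 2 (m≤m+n 3 m)

nine-quarters-minus : ℕ → ℕ → ℕ
nine-quarters-minus b n = (9 * n ∸ b) / 4

weightT-e₃ : ∀ m →
  ByResidue 3 (nine-quarters-minus 27) (nine-quarters-minus 20) (4 + m) (weightT (e (4 + m) 3))
weightT-e₃ 0 = (λ ()) , (λ _ → refl)
weightT-e₃ 1 = (λ ()) , (λ _ → refl)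
weightT-e₃ 2 = (λ ()) , (λ _ → refl)
weightT-e₃ 3 = (λ _ → refl) , (λ r≢3 → ⊥-elim (r≢3 refl))
weightT-e₃ (suc (suc (suc (suc m)))) =
  subst (ByResidue 3 (nine-quarters-minus 27) (nine-quarters-minus 20) (8 + m))
        (sym (weightT-e-periodic 4 3 m refl))
        (ByResidue-step (nine-quarters-minus 27) (nine-quarters-minus 20) (4 + m) 9
          (*-+-∸-/ 9 4 (4 + m) 27 4 (divides-refl 9) 9*3≤9*n)
          (*-+-∸-/ 9 4 (4 + m) 20 4 (divides-refl 9) (≤-trans (m≤m+n 20 7) 9*3≤9*n))
          (weightT-e₃ m))
  where
  9*3≤9*n : 9 * 3 ≤ 9 * (4 + m)
  9*3≤9*n = *-monoʳ-≤ 9 (m≤m+n 3 (suc m))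

proposition3p1 : (∀ (n : ℕ) → 1 ≤ n → weightT (e n 0) ≡ n)
    × (∀ (n : ℕ) → 2 ≤ n → weightT (e n 1) ≡ (3 * n ∸ 2) / 2)
    × (∀ (n : ℕ) → 3 ≤ n →
    (n % 4 ≡ 2 → weightT (e n 2) ≡ 2 * n ∸ 4)
    × (n % 4 ≢ 2 → weightT (e n 2) ≡ 2 * n ∸ 3))
    × (∀ (n : ℕ) → 4 ≤ n →
    (n % 4 ≡ 3 → weightT (e n 3) ≡ (9 * n ∸ 27) / 4)
    × (n % 4 ≢ 3 → weightT (e n 3) ≡ (9 * n ∸ 20) / 4))
proposition3p1 = part₀ , part₁ , part₂ , part₃
  where
  part₀ : ∀ n → 1 ≤ n → weightT (e n 0) ≡ n
  part₀ (suc m) _ = weightT-e₀ m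

  part₁ : ∀ n → 2 ≤ n → weightT (e n 1) ≡ (3 * n ∸ 2) / 2
  part₁ (suc (suc m)) _ = weightT-e₁ m
  part₁ 1 (s≤s ())

  part₂ : ∀ n → 3 ≤ n → ByResidue 2 twice-minus-4 twice-minus-3 n (weightT (e n 2))
  part₂ (suc (suc (suc m))) _ = weightT-e₂ m
  part₂ 1 (s≤s ())
  part₂ 2 (s≤s (s≤s ()))

  part₃ : ∀ n → 4 ≤ n →
    ByResidue 3 (nine-quarters-minus 27) (nine-quarters-minus 20) n (weightT (e n 3))
  part₃ (suc (suc (suc (suc m)))) _ = weightT-e₃ m
  part₃ 1 (s≤s ())
  part₃ 2 (s≤s (s≤s ()))
  part₃ 3 (s≤s (s≤s (s≤s ())))
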